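{- Let $\Gamma$ be a digraph, let $N$ be a maximum-cardinality even factor in $\Gamma$, and let $\mathcal{T}$ be a complete alternating forest for $N$. If $v$ is a node of $\Gamma$ such that $v^1$ is not $\mathcal{T}$-reachable, then $\mathrm{def}(\Gamma \ast v) = \mathrm{def}(\Gamma) + 1$ and $N$ is a maximum-cardinality even factor in $\Gamma \ast v$, where $\Gamma \ast v$ is obtained from $\Gamma$ by adding a new node $v'$ and a single arc $(v,v')$.
   Context: Digraphs may have parallel arcs but no loops. A path or cycle is even (odd) if it has an even (odd) number of arcs. A path-cycle matching of a digraph $H$ is an arc set that is a union of node-disjoint simple paths and simple cycles; it is an even factor if it contains no odd cycle. For an even factor $M$, $\mathrm{def}(H,M) = |VH| - |M|$ and $\mathrm{def}(H) = \min_M \mathrm{def}(H,M)$ over even factors $M$ of $H$. Auxiliary digraph: take two disjoint copies $V^1 = \{u^1 : u \in VH\}$ and $V^2 = \{u^2 : u \in VH\}$ of $VH$; for each arc $a=(u,v)$ of $H$ put an arc between $u^1$ and $v^2$, directed from $v^2$ to $u^1$ if $a \in M$ and from $u^1$ to $v^2$ otherwise. Call this digraph $\vec H(M)$. A node $u^1$ not covered by the arcs corresponding to $M$ is a source; a node $u^2$ not so covered is a sink. An alternating forest for $M$ is a directed out-forest in $\vec H(M)$ whose roots are exactly all the source nodes and in which every path from a root to a leaf has an even number of arcs. A node is $\mathcal{T}$-reachable if it belongs to the forest $\mathcal{T}$. An alternating forest $\mathcal{T}$ is complete if it contains no sink node and for every arc $(x,y)$ of $\vec H(M)$, if $x$ is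 $\mathcal{T}$-reachable then so is $y$. -}

module Defs where

open import Data.Nat using (ℕ; zero; suc; _∸_; _≤_)
open import Data.Fin using (Fin; zero; suc; inject₁; fromℕ)
open import Data.Fin.Subset using (Subset; _∈_; _∉_; ∣_∣; outside)
open import Data.Vec using (_∷_; lookup)
open import Data.Bool using (if_then_else_)
open import Data.Product using (Σ; ∃; _×_; _,_)
open import Data.Sum using (_⊎_)
open import Relation.Binary.PropositionalEquality using (_≡_; _≢_)
open import Relation.Nullary using (¬_)
open import Function.Definitions using (Injective)

data Even : ℕ → Set where
  even-zero : Even zero
  even-ss   : ∀ {k} → Even k → Even (suc (suc k))

Odd : ℕ → Set
Odd k = Even (suc k)

-- A finite digraph with parallel arcs allowed and no loops.
-- Nodes are Fin n, arcs are Fin m; arc a goes from tail a to head a.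
record Digraph : Set where
  field
    n      : ℕ
    m      : ℕ
    tail   : Fin m → Fin n
    head   : Fin m → Fin n
    noLoop : ∀ a → tail a ≢ head a
open Digraph public

ArcSet : Digraph → Set
ArcSet H = Subset (m H)

-- Path-cycle matching: an arc set in which every node has at most one
-- leaving and at most one entering arc (i.e. a union of node-disjoint
-- simple paths and simple cycles).
PathCycleMatching : (H : Digraph) → ArcSet H → Set
PathCycleMatching H M =
  (∀ a b → a ∈ M → b ∈ M → tail H a ≡ tail H b → a ≡ b) ×
  (∀ a b → a ∈ M → b ∈ M → head H a ≡ head H b → a ≡ b)

record CycleIn (H : Digraph) (M : ArcSet H) (j : ℕ) : Set where
  field
    c       : Fin (suc j) → Fin (m H)
    inM     : ∀ i → c i ∈ M
    simple  : ∀ i i' → tail H (c i) ≡ tail H (c i') → i ≡ i'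
    consec  : ∀ (i : Fin j) → head H (c (inject₁ i)) ≡ tail H (c (suc i))
    closing : head H (c (fromℕ j)) ≡ tail H (c zero)

HasOddCycle : (H : Digraph) → ArcSet H → Set
HasOddCycle H M = Σ ℕ λ j → Odd (suc j) × CycleIn H M j

EvenFactor : (H : Digraph) → ArcSet H → Set
EvenFactor H M = PathCycleMatching H M × ¬ HasOddCycle H M

defM : (H : Digraph) → ArcSet H → ℕ
defM H M = n H ∸ ∣ M ∣

IsDef : Digraph → ℕ → Set
IsDef H d =
  (Σ (ArcSet H) λ M → EvenFactor H M × defM H M ≡ d) ×
  (∀ M → EvenFactor H M → d ≤ defM H M)

MaxEvenFactor : (H : Digraph) → ArcSet H → Set
MaxEvenFactor H M = EvenFactor H M × (∀ M' → EvenFactor H M' → ∣ M' ∣ ≤ ∣ M ∣)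

-- The auxiliary digraph H(M): nodes u¹ (one u) and u² (two u).
-- Its arcs are indexed by the arcs of H: arc a = (u,v) gives v² → u¹
-- if a ∈ M, and u¹ → v² otherwise.

data AuxNode (k : ℕ) : Set where
  one : Fin k → AuxNode k
  two : Fin k → AuxNode k

auxTail : (H : Digraph) → ArcSet H → Fin (m H) → AuxNode (n H)
auxTail H M a = if lookup M a then two (head H a) else one (tail H a)

auxHead : (H : Digraph) → ArcSet H → Fin (m H) → AuxNode (n H)
auxHead H M a = if lookup M a then one (tail H a) else two (head H a)

IsSource : (H : Digraph) → ArcSet H → AuxNode (n H) → Set
IsSource H M (one u) = ∀ a → a ∈ M → tail H a ≢ u
IsSource H M (two u) = ⊥'
  where open import Data.Empty renaming (⊥ to ⊥')

IsSink : (H : Digraph) → ArcSet H → AuxNode (n H) → Set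
IsSink H M (one u) = ⊥'
  where open import Data.Empty renaming (⊥ to ⊥')
IsSink H M (two u) = ∀ a → a ∈ M → head H a ≢ u

-- Forests in H(M), given by a set T of arcs of H(M) (indexed by arcs of H).
-- The node set of the forest consists of the roots (all source nodes)
-- together with the endpoints of arcs of T.

-- Node belongs to the forest T (i.e. is T-reachable)
InForest : (H : Digraph) (M : ArcSet H) (T : Subset (m H)) → AuxNode (n H) → Set
InForest H M T x = IsSource H M x ⊎ (∃ λ a → a ∈ T × auxHead H M a ≡ x)

data TPath (H : Digraph) (M : ArcSet H) (T : Subset (m H))
     : AuxNode (n H) → AuxNode (n H) → ℕ → Set where
  here : ∀ {x} → TPath H M T x x zero
  step : ∀ {x k} a → a ∈ T → TPath H M T (auxHead H M a) x k →
         TPath H M T (auxTail H M a) x (suc k)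

IsLeaf : (H : Digraph) (M : ArcSet H) (T : Subset (m H)) → AuxNode (n H) → Set
IsLeaf H M T x = InForest H M T x × (∀ a → a ∈ T → auxTail H M a ≢ x)

-- T is an alternating forest for M:
--  * T is a directed out-forest: every node has at most one entering T-arc,
--    the tail of every T-arc is a forest node, and every forest node is
--    reached by a T-path from a root;
--  * its roots (forest nodes with no entering T-arc) are exactly the sources;
--  * every root-to-leaf path has an even number of arcs.
record AlternatingForest (H : Digraph) (M : ArcSet H) (T : Subset (m H)) : Set where
  field
    inDeg≤1     : ∀ a b → a ∈ T → b ∈ T → auxHead H M a ≡ auxHead H M b → a ≡ b
    tailInForest : ∀ a → a ∈ T → InForest H M T (auxTail H M a)
    rootsReach  : ∀ x → InForest H M T x →
                  ∃ λ s → IsSource H M s × ∃ λ k → TPath H M T s x k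
    sourcesRoots : ∀ a → a ∈ T → ¬ IsSource H M (auxHead H M a)
    evenLeaves  : ∀ s x k → IsSource H M s → IsLeaf H M T x →
                  TPath H M T s x k → Even k

record CompleteAlternatingForest (H : Digraph) (M : ArcSet H) (T : Subset (m H)) : Set where
  field
    forest  : AlternatingForest H M T
    noSink  : ∀ x → InForest H M T x → ¬ IsSink H M x
    closed  : ∀ a → InForest H M T (auxTail H M a) → InForest H M T (auxHead H M a)

-- Γ ∗ v : add a new node v' (index zero; old node u becomes suc u)
-- and a single new arc (v, v') (index zero; old arc a becomes suc a).

addPendant : (Γ : Digraph) → Fin (n Γ) → Digraph
addPendant Γ v = record
  { n = suc (n Γ)
  ; m = suc (m Γ)
  ; tail = tl
  ; head = hd
  ; noLoop = nl
  }
  where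
    tl : Fin (suc (m Γ)) → Fin (suc (n Γ))
    tl zero    = suc v
    tl (suc a) = suc (tail Γ a)
    hd : Fin (suc (m Γ)) → Fin (suc (n Γ))
    hd zero    = zero
    hd (suc a) = suc (head Γ a)
    nl : ∀ a → tl a ≢ hd a
    nl zero ()
    nl (suc a) eq = noLoop Γ a (Data.Fin.Properties.suc-injective eq)
      where import Data.Fin.Properties

liftArcs : (Γ : Digraph) (v : Fin (n Γ)) → ArcSet Γ → ArcSet (addPendant Γ v)
liftArcs Γ v N = outside ∷ N

module Submission where

-- Proof idea (a Kőnig-type duality argument).  Let K₁ be the nodes u with u¹
-- NOT T-reachable and K₂ the nodes w with w² T-reachable.  Completeness of T
-- makes (K₁, K₂) a "matching cover" of Γ by N: every u ∈ K₁ is the tail of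
-- an N-arc (u¹ is no source, sources being roots), every w ∈ K₂ is the head
-- of an N-arc (no sinks), and no N-arc c has tail c ∈ K₁ and head c ∈ K₂
-- (its auxiliary arc runs (head c)² → (tail c)¹ and reachability is closed
-- along arcs).  Moreover every arc of Γ has its tail in K₁ or its head in K₂.
-- Charging each arc of a path-cycle matching to the N-arc covering its tail
-- or head is injective, so no path-cycle matching is larger than N.  In Γ ∗ v
-- the new arc (v, v') is charged via its tail, since v ∈ K₁ by hypothesis.
-- So N stays a maximum even factor of Γ ∗ v, and as def = |V| - |N| for a
-- maximum even factor, the new node raises the deficiency by exactly one.

open import Defs
open import Data.Nat using (suc; zero; _≤_; _∸_; z≤n; s≤s)
open import Data.Nat.Properties using (≤-trans; ≤-antisym; ∸-monoʳ-≤; +-∸-assoc)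
open import Data.Fin using (Fin; zero; suc; inject₁; fromℕ)
open import Data.Fin.Properties using (any?; suc-injective; 0≢1+n) renaming (_≟_ to _≟F_)
open import Data.Fin.Subset using (Subset; _∈_; _∉_; ∣_∣; inside; outside; ⊤; _-_)
open import Data.Fin.Subset.Properties
  using (_∈?_; ∈⊤; ∣⊤∣≡n; x∈p⇒∣p-x∣<∣p∣; x∈p∧x≢y⇒x∈p-y)
open import Data.Vec using ([]; _∷_; lookup; here; there)
open import Data.Vec.Properties using ([]=⇒lookup; lookup⇒[]=)
open import Data.Bool using (true; false)
open import Data.Product using (Σ; ∃; _×_; _,_; proj₁; proj₂)
open import Data.Sum using (_⊎_; inj₁; inj₂)
open import Data.Empty using (⊥; ⊥-elim)
open import Relation.Nullary using (¬_; Dec; yes; no)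
open import Relation.Nullary.Decidable using (_×-dec_; _⊎-dec_)
open import Relation.Binary.PropositionalEquality
  using (_≡_; _≢_; refl; sym; trans; cong; subst)

injection⇒∣∣≤ : ∀ {a b} (M : Subset a) (S : Subset b) (f : Fin a → Fin b) →
                (∀ {i} → i ∈ M → f i ∈ S) →
                (∀ {i j} → i ∈ M → j ∈ M → f i ≡ f j → i ≡ j) →
                ∣ M ∣ ≤ ∣ S ∣
injection⇒∣∣≤ [] S f into inj = z≤n
injection⇒∣∣≤ (outside ∷ M) S f into inj =
  injection⇒∣∣≤ M S (λ i → f (suc i)) (λ p → into (there p))
    (λ p q e → suc-injective (inj (there p) (there q) e))
injection⇒∣∣≤ (inside ∷ M) S f into inj =
  ≤-trans (s≤s (injection⇒∣∣≤ M (S - f zero) (λ i → f (suc i)) intoRest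
                  (λ p q e → suc-injective (inj (there p) (there q) e))))
          (x∈p⇒∣p-x∣<∣p∣ (into here))
  where
    intoRest : ∀ {i} → i ∈ M → f (suc i) ∈ S - f zero
    intoRest p = x∈p∧x≢y⇒x∈p-y (into (there p)) (λ e → 0≢1+n (inj here (there p) (sym e)))

-- A path-cycle matching has at most one arc per node, as its tails are distinct.
pathCycleMatching-size : (H : Digraph) (M : ArcSet H) → PathCycleMatching H M → ∣ M ∣ ≤ n H
pathCycleMatching-size H M (tailInj , _) =
  subst (∣ M ∣ ≤_) (∣⊤∣≡n (n H))
    (injection⇒∣∣≤ M ⊤ (tail H) (λ _ → ∈⊤) (λ p q e → tailInj _ _ p q e))

module Orientation (H : Digraph) (M : ArcSet H) where

  ∉⇒lookup≡false : ∀ a → a ∉ M → lookup M a ≡ false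
  ∉⇒lookup≡false a a∉M with lookup M a in eq
  ... | true  = ⊥-elim (a∉M (lookup⇒[]= a M eq))
  ... | false = refl

  auxTail-∈ : ∀ a → a ∈ M → auxTail H M a ≡ two (head H a)
  auxTail-∈ a a∈M rewrite []=⇒lookup a∈M = refl

  auxHead-∈ : ∀ a → a ∈ M → auxHead H M a ≡ one (tail H a)
  auxHead-∈ a a∈M rewrite []=⇒lookup a∈M = refl

  auxTail-∉ : ∀ a → a ∉ M → auxTail H M a ≡ one (tail H a)
  auxTail-∉ a a∉M rewrite ∉⇒lookup≡false a a∉M = refl

  auxHead-∉ : ∀ a → a ∉ M → auxHead H M a ≡ two (head H a)
  auxHead-∉ a a∉M rewrite ∉⇒lookup≡false a a∉M = refl

one-injective : ∀ {k} {x y : Fin k} → one x ≡ one y → x ≡ y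
one-injective refl = refl

two≢one : ∀ {k} {x y : Fin k} → two x ≢ one y
two≢one ()

_≟A_ : ∀ {k} (x y : AuxNode k) → Dec (x ≡ y)
one x ≟A one y with x ≟F y
... | yes refl = yes refl
... | no x≢y   = no λ { refl → x≢y refl }
one x ≟A two y = no λ ()
two x ≟A one y = no λ ()
two x ≟A two y with x ≟F y
... | yes refl = yes refl
... | no x≢y   = no λ { refl → x≢y refl }

-- It certifies an upper bound on every path-cycle matching.
record MatchingCover (Γ : Digraph) (N : ArcSet Γ) : Set₁ where
  field
    K₁ K₂      : Fin (n Γ) → Set
    K₁-matched : ∀ u → K₁ u → ∃ λ c → c ∈ N × tail Γ c ≡ u
    K₂-matched : ∀ w → K₂ w → ∃ λ c → c ∈ N × head Γ c ≡ w
    separated  : ∀ c → c ∈ N → K₁ (tail Γ c) → K₂ (head Γ c) → ⊥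

module Charging {Γ : Digraph} {N : ArcSet Γ} (C : MatchingCover Γ N)
                (H' : Digraph) (ι : Fin (n Γ) → Fin (n H')) where
  open MatchingCover C

  data Charge (a : Fin (m H')) : Set where
    viaTail : ∀ c → c ∈ N → K₁ (tail Γ c) → tail H' a ≡ ι (tail Γ c) → Charge a
    viaHead : ∀ c → c ∈ N → K₂ (head Γ c) → head H' a ≡ ι (head Γ c) → Charge a

  chargeTail : ∀ a u → K₁ u → tail H' a ≡ ι u → Charge a
  chargeTail a u k e with K₁-matched u k
  ... | c , c∈N , refl = viaTail c c∈N k e

  chargeHead : ∀ a w → K₂ w → head H' a ≡ ι w → Charge a
  chargeHead a w k e with K₂-matched w k
  ... | c , c∈N , refl = viaHead c c∈N k e

  charged : ∀ {a} → Charge a → Fin (m Γ)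
  charged (viaTail c _ _ _) = c
  charged (viaHead c _ _ _) = c

  charged-∈ : ∀ {a} (r : Charge a) → charged r ∈ N
  charged-∈ (viaTail _ c∈N _ _) = c∈N
  charged-∈ (viaHead _ c∈N _ _) = c∈N

  -- Arcs of a path-cycle matching charged to the same N-arc coincide: they
  -- share a tail or a head, and mixed charges are excluded by separation.
  charge-injective : ∀ {M'} → PathCycleMatching H' M' → ∀ {a a'} → a ∈ M' → a' ∈ M' →
                     (r : Charge a) (r' : Charge a') → charged r ≡ charged r' → a ≡ a'
  charge-injective (tailInj , _) p p' (viaTail c _ _ e) (viaTail .c _ _ e') refl =
    tailInj _ _ p p' (trans e (sym e'))
  charge-injective (_ , headInj) p p' (viaHead c _ _ e) (viaHead .c _ _ e') refl =
    headInj _ _ p p' (trans e (sym e'))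
  charge-injective _ _ _ (viaTail c c∈N k₁ _) (viaHead .c _ k₂ _) refl =
    ⊥-elim (separated c c∈N k₁ k₂)
  charge-injective _ _ _ (viaHead c c∈N k₂ _) (viaTail .c _ k₁ _) refl =
    ⊥-elim (separated c c∈N k₁ k₂)

  cover-bound : ∀ M' → PathCycleMatching H' M' → (∀ a → Charge a) → ∣ M' ∣ ≤ ∣ N ∣
  cover-bound M' pcm charge =
    injection⇒∣∣≤ M' N (λ a → charged (charge a)) (λ {a} _ → charged-∈ (charge a))
      (λ {a} {a'} p p' → charge-injective pcm p p' (charge a) (charge a'))

module CompleteForestCover (Γ : Digraph) (N : ArcSet Γ) (pcmN : PathCycleMatching Γ N)
                           (T : ArcSet Γ) (CF : CompleteAlternatingForest Γ N T) where
  open CompleteAlternatingForest CF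
  open AlternatingForest forest
  open Orientation Γ N

  Reached : AuxNode (n Γ) → Set
  Reached = InForest Γ N T

  tail-matched? : ∀ u → Dec (∃ λ c → c ∈ N × tail Γ c ≡ u)
  tail-matched? u = any? (λ c → (c ∈? N) ×-dec (tail Γ c ≟F u))

  head-matched? : ∀ w → Dec (∃ λ c → c ∈ N × head Γ c ≡ w)
  head-matched? w = any? (λ c → (c ∈? N) ×-dec (head Γ c ≟F w))

  reached? : ∀ u → Dec (Reached (one u))
  reached? u = source? ⊎-dec any? (λ a → (a ∈? T) ×-dec (auxHead Γ N a ≟A one u))
    where
      source? : Dec (IsSource Γ N (one u))
      source? with tail-matched? u
      ... | yes (c , c∈N , e) = no λ s → s c c∈N e
      ... | no none           = yes λ c c∈N e → none (c , c∈N , e)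

  -- u¹ unreachable: u¹ is not a source (sources are roots), so N covers u.
  unreached-matched : ∀ u → ¬ Reached (one u) → ∃ λ c → c ∈ N × tail Γ c ≡ u
  unreached-matched u nr with tail-matched? u
  ... | yes found = found
  ... | no none   = ⊥-elim (nr (inj₁ λ c c∈N e → none (c , c∈N , e)))

  -- w² reachable: the forest contains no sink, so N covers w.
  reached-matched : ∀ w → Reached (two w) → ∃ λ c → c ∈ N × head Γ c ≡ w
  reached-matched w r with head-matched? w
  ... | yes found = found
  ... | no none   = ⊥-elim (noSink (two w) r λ c c∈N e → none (c , c∈N , e))

  -- For an N-arc c the auxiliary arc goes (head c)² → (tail c)¹.
  N-arc-closed : ∀ c → c ∈ N → Reached (two (head Γ c)) → Reached (one (tail Γ c))
  N-arc-closed c c∈N r =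
    subst Reached (auxHead-∈ c c∈N) (closed c (subst Reached (sym (auxTail-∈ c c∈N)) r))

  -- For b ∉ N
  -- this is closure; for b ∈ N, (tail b)¹ is no source, so it is entered by
  -- a T-arc, which must be the auxiliary arc of b itself.
  reached-tail⇒reached-head : ∀ b → Reached (one (tail Γ b)) → Reached (two (head Γ b))
  reached-tail⇒reached-head b r with b ∈? N
  ... | no b∉N = subst Reached (auxHead-∉ b b∉N) (closed b (subst Reached (sym (auxTail-∉ b b∉N)) r))
  reached-tail⇒reached-head b (inj₁ source) | yes b∈N = ⊥-elim (source b b∈N refl)
  reached-tail⇒reached-head b (inj₂ (c , c∈T , e)) | yes b∈N with c ∈? N
  ... | no c∉N = ⊥-elim (two≢one (trans (sym (auxHead-∉ c c∉N)) e))
  ... | yes c∈N = subst (λ x → Reached (two (head Γ x))) c≡b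
                    (subst Reached (auxTail-∈ c c∈N) (tailInForest c c∈T))
    where
      c≡b : c ≡ b
      c≡b = proj₁ pcmN c b c∈N b∈N (one-injective (trans (sym (auxHead-∈ c c∈N)) e))

  forestCover : MatchingCover Γ N
  forestCover = record
    { K₁ = λ u → ¬ Reached (one u)
    ; K₂ = λ w → Reached (two w)
    ; K₁-matched = unreached-matched
    ; K₂-matched = reached-matched
    ; separated  = λ c c∈N nr r → nr (N-arc-closed c c∈N r)
    }

  arc-covered : ∀ b → ¬ Reached (one (tail Γ b)) ⊎ Reached (two (head Γ b))
  arc-covered b with reached? (tail Γ b)
  ... | yes r = inj₂ (reached-tail⇒reached-head b r)
  ... | no nr = inj₁ nr

max⇒IsDef : (H : Digraph) (M : ArcSet H) → MaxEvenFactor H M → IsDef H (defM H M)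
max⇒IsDef H M (efM , maxM) = (M , efM , refl) , λ M' efM' → ∸-monoʳ-≤ (n H) (maxM M' efM')

IsDef-unique : ∀ {H d d'} → IsDef H d → IsDef H d' → d ≡ d'
IsDef-unique ((M , efM , refl) , minD) ((M' , efM' , refl) , minD') =
  ≤-antisym (minD M' efM') (minD' M efM)

module PendantLift (Γ : Digraph) (v : Fin (n Γ)) (N : ArcSet Γ) where

  Γ* : Digraph
  Γ* = addPendant Γ v

  L : ArcSet Γ*
  L = liftArcs Γ v N

  lifted-arc : ∀ a → a ∈ L → Σ (Fin (m Γ)) λ b → a ≡ suc b × b ∈ N
  lifted-arc (suc b) (there b∈N) = b , refl , b∈N

  lift-pathCycleMatching : PathCycleMatching Γ N → PathCycleMatching Γ* L
  lift-pathCycleMatching (tailInj , headInj) = tailInj* , headInj*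
    where
      tailInj* : ∀ a b → a ∈ L → b ∈ L → tail Γ* a ≡ tail Γ* b → a ≡ b
      tailInj* (suc a) (suc b) (there p) (there q) e = cong suc (tailInj a b p q (suc-injective e))
      headInj* : ∀ a b → a ∈ L → b ∈ L → head Γ* a ≡ head Γ* b → a ≡ b
      headInj* (suc a) (suc b) (there p) (there q) e = cong suc (headInj a b p q (suc-injective e))

  -- a cycle in L avoids the new arc, so it is a cycle of N of the same length
  lower-cycle : ∀ {j} → CycleIn Γ* L j → CycleIn Γ N j
  lower-cycle {j} C = record
    { c       = c'
    ; inM     = λ i → proj₂ (proj₂ (lifted-arc (c i) (inM i)))
    ; simple  = λ i i' e → simple i i' (trans (tail≡ i) (trans (cong suc e) (sym (tail≡ i'))))
    ; consec  = λ i → suc-injective (trans (sym (head≡ (inject₁ i))) (trans (consec i) (tail≡ (suc i))))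
    ; closing = suc-injective (trans (sym (head≡ (fromℕ j))) (trans closing (tail≡ zero)))
    }
    where
      open CycleIn C
      c' : Fin (suc j) → Fin (m Γ)
      c' i = proj₁ (lifted-arc (c i) (inM i))
      c≡ : ∀ i → c i ≡ suc (c' i)
      c≡ i = proj₁ (proj₂ (lifted-arc (c i) (inM i)))
      tail≡ : ∀ i → tail Γ* (c i) ≡ suc (tail Γ (c' i))
      tail≡ i = cong (tail Γ*) (c≡ i)
      head≡ : ∀ i → head Γ* (c i) ≡ suc (head Γ (c' i))
      head≡ i = cong (head Γ*) (c≡ i)

  lift-evenFactor : EvenFactor Γ N → EvenFactor Γ* L
  lift-evenFactor (pcm , noOdd) =
    lift-pathCycleMatching pcm , λ { (j , odd , C) → noOdd (j , odd , lower-cycle C) }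

  -- the new node is left uncovered, so the deficiency of L is one larger
  lift-defM : ∣ N ∣ ≤ n Γ → defM Γ* L ≡ suc (defM Γ N)
  lift-defM = +-∸-assoc 1

lemma5 : (Γ : Digraph) (N : ArcSet Γ) → MaxEvenFactor Γ N →
         (T : ArcSet Γ) → CompleteAlternatingForest Γ N T →
         (v : Fin (n Γ)) → ¬ InForest Γ N T (one v) →
         (∀ d → IsDef Γ d → IsDef (addPendant Γ v) (suc d)) ×
         MaxEvenFactor (addPendant Γ v) (liftArcs Γ v N)
lemma5 Γ N maxN@(efN@(pcmN , _) , _) T CF v v¹-unreached = deficiency , maxL
  where
    open CompleteForestCover Γ N pcmN T CF
    open PendantLift Γ v N
    open Charging forestCover Γ* suc

    -- the new arc is charged via its tail v; old arcs as in Γ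
    charge : ∀ a → Charge a
    charge zero    = chargeTail zero v v¹-unreached refl
    charge (suc b) with arc-covered b
    ... | inj₁ k₁ = chargeTail (suc b) (tail Γ b) k₁ refl
    ... | inj₂ k₂ = chargeHead (suc b) (head Γ b) k₂ refl

    maxL : MaxEvenFactor Γ* L
    maxL = lift-evenFactor efN , λ M' (pcm' , _) → cover-bound M' pcm' charge

    deficiency : ∀ d → IsDef Γ d → IsDef Γ* (suc d)
    deficiency d defΓ = subst (IsDef Γ*) defL≡suc-d (max⇒IsDef Γ* L maxL)
      where
        defL≡suc-d : defM Γ* L ≡ suc d
        defL≡suc-d = trans (lift-defM (pathCycleMatching-size Γ N pcmN))
                           (cong suc (IsDef-unique (max⇒IsDef Γ N maxN) defΓ))
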